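{- Let $H$ be any graph and let $r \geq 3$ be odd. Then $\mathrm{gp}^-(C_r \,\square\, H) = 3$, unless $H$ has a universal line consisting of two adjacent vertices (i.e. unless there are adjacent vertices $u,v$ of $H$ with $\mathcal{L}(u,v) = V(H)$).
   Context: All graphs are simple and undirected; $C_r$ is the cycle of length $r$. A set $S \subseteq V(G)$ is in general position if no shortest path of $G$ contains three vertices of $S$; $\mathrm{gp}^-(G)$ is the order of a smallest maximal general position set of $G$. For vertices $u,v$ of $G$, the line $\mathcal{L}(u,v) = \{w \in V(G) : d(u,v) = d(u,w)+d(w,v) \text{ or } d(u,v) = |d(u,w)-d(w,v)|\}$; it is universal if it equals $V(G)$. The Cartesian product $G \,\square\, H$ has vertex set $V(G)\times V(H)$, with $(u_1,v_1) \sim (u_2,v_2)$ iff either $u_1=u_2$ and $v_1 \sim v_2$ in $H$, or $u_1 \sim u_2$ in $G$ and $v_1 = v_2$. -}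

module Defs where

open import Data.Nat using (ℕ; zero; suc; _+_; _*_; _≤_; ∣_-_∣)
open import Data.Fin using (Fin; toℕ)
open import Data.Product using (Σ; ∃; ∃-syntax; _×_; _,_)
open import Data.Sum using (_⊎_)
open import Data.List using (List; _∷_; length)
open import Data.List.Membership.Propositional using (_∈_; _∉_)
open import Data.List.Relation.Unary.Unique.Propositional using (Unique)
open import Data.Empty using (⊥)
open import Relation.Nullary using (¬_)
open import Relation.Binary.PropositionalEquality using (_≡_; _≢_)

record Graph : Set₁ where
  field
    V   : Set
    Adj : V → V → Set
open Graph public

-- Standing hypotheses for "graph" in the paper: finite, simple (undirected,
-- loopless), connected, nonempty.
Finite : Graph → Set
Finite G = Σ (List (V G)) λ xs → ∀ v → v ∈ xs

Symmetric : Graph → Set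
Symmetric G = ∀ {x y} → Adj G x y → Adj G y x

Irreflexive : Graph → Set
Irreflexive G = ∀ {x} → ¬ Adj G x x

data Walk (G : Graph) : V G → V G → ℕ → Set where
  []   : ∀ {u} → Walk G u u 0
  step : ∀ {u w v k} → Adj G u w → Walk G w v k → Walk G u v (suc k)

data _∈W_ {G : Graph} (x : V G) : ∀ {u v k} → Walk G u v k → Set where
  here  : ∀ {u v k} {p : Walk G u v k} → x ≡ u → x ∈W p
  there : ∀ {u w v k} {a : Adj G u w} {p : Walk G w v k} → x ∈W p → x ∈W step a p

Connected : Graph → Set
Connected G = ∀ u v → ∃[ k ] Walk G u v k

IsShortest : ∀ {G u v k} → Walk G u v k → Set
IsShortest {G} {u} {v} {k} _ = ∀ k′ → Walk G u v k′ → k ≤ k′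

Dist : (G : Graph) → V G → V G → ℕ → Set
Dist G u v m = Walk G u v m × (∀ k → Walk G u v k → m ≤ k)

GenPos : (G : Graph) → List (V G) → Set
GenPos G S =
  ∀ {u v k} (p : Walk G u v k) → IsShortest p →
  ∀ x y z → x ∈ S → y ∈ S → z ∈ S → x ≢ y → y ≢ z → x ≢ z →
  x ∈W p → y ∈W p → z ∈W p → ⊥

-- maximal general position set (a set = duplicate-free list)
MaximalGP : (G : Graph) → List (V G) → Set
MaximalGP G S = Unique S × GenPos G S × (∀ x → x ∉ S → ¬ GenPos G (x ∷ S))

gpMinus≡ : Graph → ℕ → Set
gpMinus≡ G m =
  (∃[ S ] (MaximalGP G S × length S ≡ m)) × (∀ S → MaximalGP G S → m ≤ length S)

InLine : (G : Graph) → V G → V G → V G → Set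
InLine G u v w =
  ∃[ a ] ∃[ b ] ∃[ c ] (Dist G u v a × Dist G u w b × Dist G w v c ×
    (a ≡ b + c ⊎ a ≡ ∣ b - c ∣))

UniversalLine : (G : Graph) → V G → V G → Set
UniversalLine G u v = ∀ w → InLine G u v w

CycSucc : ∀ {r} → Fin r → Fin r → Set
CycSucc {r} x y = (toℕ y ≡ suc (toℕ x)) ⊎ (suc (toℕ x) ≡ r × toℕ y ≡ 0)

C : ℕ → Graph
C r = record { V = Fin r ; Adj = λ x y → CycSucc x y ⊎ CycSucc y x }

_□_ : Graph → Graph → Graph
G □ H = record
  { V   = V G × V H
  ; Adj = λ { (g₁ , h₁) (g₂ , h₂) →
              (g₁ ≡ g₂ × Adj H h₁ h₂) ⊎ (Adj G g₁ g₂ × h₁ ≡ h₂) } }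

Odd : ℕ → Set
Odd r = ∃[ k ] r ≡ suc (2 * k)

-- Write r = 2k + 1. A walk in C_r □ H splits into walks in the two factors, so
-- betweenness in the product projects to betweenness in each factor, while
-- geodesics of the factors combine into geodesics of the product. Three vertices
-- are in general position exactly when none of them lies between the other two.
--
-- The cycle vertices 0, k, k + 1 cut C_r into arcs of lengths k, 1, k, none longer
-- than half the cycle, so none of them lies between the other two and
-- {0, k, k + 1} × {h₀} is in general position. It is maximal: every cycle vertex i
-- sees two of 0, k, k + 1 on a geodesic, and combining that geodesic with a g–h₀
-- geodesic of H puts (i, g) and two points of the set on one geodesic.
--
-- Conversely no set of at most two vertices is maximal. A pair with different cycle
-- coordinates i ≠ j is completed by a cycle vertex w such that i, j, w cut C_r into
-- arcs of length at most k. A pair (i, g), (i, h) with d(g, h) ≥ 2 is completed by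
-- (w, f) with w ≠ i and f the neighbour of g on a g–h geodesic. If g ~ h, the line
-- L(g, h) is not universal, and (i, f) with f ∉ L(g, h) completes the pair, because
-- three vertices of one H-layer are collinear only if their H-coordinates are.
module Submission where

open import Defs
open import Algebra.Properties.CommutativeSemigroup using (interchange)
open import Data.Empty using (⊥; ⊥-elim)
open import Data.Fin using (Fin; zero; toℕ; _≟_)
open import Data.Fin.Properties using (toℕ-injective; toℕ<n; toℕ-fromℕ<)
open import Data.List using (List; []; _∷_; length)
open import Data.List.Membership.Propositional using (_∈_; _∉_)
open import Data.List.Relation.Unary.All using ([]; _∷_)
open import Data.List.Relation.Unary.AllPairs using ([]; _∷_)
open import Data.List.Relation.Unary.Any using (here; there)
open import Data.List.Relation.Unary.Unique.Propositional using (Unique)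
open import Data.Nat using (ℕ; zero; suc; _+_; _*_; _≤_; _<_; z≤n; s≤s; ∣_-_∣; _≤?_)
open import Data.Nat.DivMod
  using (_%_; _/_; _mod_; m%n<n; [m+kn]%n≡m%n; m<n⇒m%n≡m; %-distribˡ-+; m%n%n≡m%n; m≡m%n+[m/n]*n; n%n≡0)
open import Data.Nat.Divisibility using (_∣_; divides; >⇒∤; ∣⇒≤)
open import Data.Nat.Properties
  using ( ≤-refl; ≤-reflexive; ≤-trans; ≤-antisym; ≤-total; ≤-pred; <⇒≤; ≤-<-trans; <-irrefl; ≰⇒>; ≮⇒≥
        ; 1+n≰n; m≤m+n; m≤n+m; m≤n⇒m≤1+n; m≤n⇒m<n∨m≡n; m≤n⇒∃[o]m+o≡n
        ; +-comm; +-assoc; +-suc; +-identityʳ; *-identityˡ; +-mono-≤; +-monoˡ-≤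
        ; +-cancelˡ-≤; +-cancelʳ-≤; +-cancelˡ-≡; ∣m-m+n∣≡n; ∣-∣-comm; +-commutativeSemigroup
        ; module ≤-Reasoning)
open import Data.Product using (∃-syntax; _×_; _,_; proj₁; proj₂)
open import Data.Sum as Sum using (_⊎_; inj₁; inj₂)
open import Function using (_∘_)
open import Relation.Nullary using (¬_; yes; no)
open import Relation.Binary.PropositionalEquality

≢⇒,≢ : ∀ {A B : Set} {a a′ : A} {b b′ : B} → a ≢ a′ → (a , b) ≢ (a′ , b′)
≢⇒,≢ a≢a′ = a≢a′ ∘ cong proj₁

pattern 1st = here refl
pattern 2nd = there (here refl)
pattern 3rd = there (there (here refl))

module _ {A : Set} where

  pigeonhole-pair : ∀ {a b P Q R : A} → P ∈ a ∷ b ∷ [] → Q ∈ a ∷ b ∷ [] → R ∈ a ∷ b ∷ [] →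
    P ≢ Q → Q ≢ R → P ≢ R → ⊥
  pigeonhole-pair 1st 1st _   P≢Q _   _   = P≢Q refl
  pigeonhole-pair 2nd 2nd _   P≢Q _   _   = P≢Q refl
  pigeonhole-pair _   1st 1st _   Q≢R _   = Q≢R refl
  pigeonhole-pair _   2nd 2nd _   Q≢R _   = Q≢R refl
  pigeonhole-pair 1st _   1st _   _   P≢R = P≢R refl
  pigeonhole-pair 2nd _   2nd _   _   P≢R = P≢R refl
  pigeonhole-pair (there (there ())) _ _ _ _ _
  pigeonhole-pair _ (there (there ())) _ _ _ _
  pigeonhole-pair _ _ (there (there ())) _ _ _

  ∉-pair : ∀ {a b P : A} → P ≢ a → P ≢ b → P ∉ a ∷ b ∷ []
  ∉-pair P≢a _   (here P≡a)         = P≢a P≡a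
  ∉-pair _   P≢b (there (here P≡b)) = P≢b P≡b

  triple-members : ∀ {Π : A → Set} {x y z P Q R} →
    P ∈ x ∷ y ∷ z ∷ [] → Q ∈ x ∷ y ∷ z ∷ [] → R ∈ x ∷ y ∷ z ∷ [] →
    P ≢ Q → Q ≢ R → P ≢ R → Π P → Π Q → Π R → Π x × Π y × Π z
  triple-members 1st 2nd 3rd _ _ _ p q r = p , q , r
  triple-members 1st 3rd 2nd _ _ _ p q r = p , r , q
  triple-members 2nd 1st 3rd _ _ _ p q r = q , p , r
  triple-members 2nd 3rd 1st _ _ _ p q r = r , p , q
  triple-members 3rd 1st 2nd _ _ _ p q r = q , r , p
  triple-members 3rd 2nd 1st _ _ _ p q r = r , q , p
  triple-members 1st 1st _   P≢Q _   _   _ _ _ = ⊥-elim (P≢Q refl)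
  triple-members 2nd 2nd _   P≢Q _   _   _ _ _ = ⊥-elim (P≢Q refl)
  triple-members 3rd 3rd _   P≢Q _   _   _ _ _ = ⊥-elim (P≢Q refl)
  triple-members _   1st 1st _   Q≢R _   _ _ _ = ⊥-elim (Q≢R refl)
  triple-members _   2nd 2nd _   Q≢R _   _ _ _ = ⊥-elim (Q≢R refl)
  triple-members _   3rd 3rd _   Q≢R _   _ _ _ = ⊥-elim (Q≢R refl)
  triple-members 1st _   1st _   _   P≢R _ _ _ = ⊥-elim (P≢R refl)
  triple-members 2nd _   2nd _   _   P≢R _ _ _ = ⊥-elim (P≢R refl)
  triple-members 3rd _   3rd _   _   P≢R _ _ _ = ⊥-elim (P≢R refl)
  triple-members (there (there (there ()))) _ _ _ _ _ _ _ _
  triple-members _ (there (there (there ()))) _ _ _ _ _ _ _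
  triple-members _ _ (there (there (there ()))) _ _ _ _ _ _

DistAtLeast : (G : Graph) → V G → V G → ℕ → Set
DistAtLeast G u v k = ∀ k′ → Walk G u v k′ → k ≤ k′

Between : (G : Graph) → V G → V G → V G → Set
Between G x y z = ∃[ a ] ∃[ b ] (Walk G x y a × Walk G y z b × DistAtLeast G x z (a + b))

Collinear : (G : Graph) → V G → V G → V G → Set
Collinear G x y z = Between G z x y ⊎ Between G x y z ⊎ Between G y z x

Extendable : (G : Graph) → List (V G) → Set
Extendable G S = ∃[ x ] x ∉ S × GenPos G (x ∷ S)

extendable⇒¬maximalGP : ∀ {G S} → Extendable G S → ¬ MaximalGP G S
extendable⇒¬maximalGP (x , x∉S , gp) (_ , _ , maximal) = maximal x x∉S gp

Collinear-map : ∀ {G G′} (f : V G → V G′) →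
  (∀ {x y z} → Between G x y z → Between G′ (f x) (f y) (f z)) →
  ∀ {x y z} → Collinear G x y z → Collinear G′ (f x) (f y) (f z)
Collinear-map _ f-between = Sum.map f-between (Sum.map f-between f-between)

AdjacentUniversalLine : Graph → Set
AdjacentUniversalLine H = ∃[ u ] ∃[ v ] (Adj H u v × UniversalLine H u v)

module _ {G : Graph} where

  infixr 5 _++ʷ_
  _++ʷ_ : ∀ {u v w a b} → Walk G u v a → Walk G v w b → Walk G u w (a + b)
  []       ++ʷ q = q
  step e p ++ʷ q = step e (p ++ʷ q)

  ∈-++ʷ⁺ʳ : ∀ {x u v w a b} (p : Walk G u v a) {q : Walk G v w b} → x ∈W q → x ∈W (p ++ʷ q)
  ∈-++ʷ⁺ʳ []         x∈q = x∈q
  ∈-++ʷ⁺ʳ (step e p) x∈q = there (∈-++ʷ⁺ʳ p x∈q)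

  ∈-++ʷ⁻ : ∀ {x u v w a b} (p : Walk G u v a) {q : Walk G v w b} →
           x ∈W (p ++ʷ q) → x ∈W p ⊎ x ∈W q
  ∈-++ʷ⁻ []         x∈q          = inj₂ x∈q
  ∈-++ʷ⁻ (step e p) (here x≡u)   = inj₁ (here x≡u)
  ∈-++ʷ⁻ (step e p) (there x∈pq) = Sum.map₁ there (∈-++ʷ⁻ p x∈pq)

  end-∈ʷ : ∀ {u v a} (p : Walk G u v a) → v ∈W p
  end-∈ʷ []         = here refl
  end-∈ʷ (step e p) = there (end-∈ʷ p)

  data SplitAt (x : V G) {u v} : ∀ {k} → Walk G u v k → Set where
    _◂_ : ∀ {a b} (p : Walk G u x a) (q : Walk G x v b) → SplitAt x (p ++ʷ q)

  splitAt : ∀ {x u v k} {p : Walk G u v k} → x ∈W p → SplitAt x p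
  splitAt {p = p}        (here refl) = [] ◂ p
  splitAt {p = step e _} (there x∈p) with splitAt x∈p
  ... | q₁ ◂ q₂ = step e q₁ ◂ q₂

  walk-0 : ∀ {u v} → Walk G u v 0 → u ≡ v
  walk-0 [] = refl

  dist-refl : ∀ {x} → Dist G x x 0
  dist-refl = [] , λ _ _ → z≤n

  adjacent⇒dist-1 : ∀ {x y} → x ≢ y → Adj G x y → Dist G x y 1
  adjacent⇒dist-1 x≢y e = step e [] , λ { zero p → ⊥-elim (x≢y (walk-0 p)) ; (suc _) _ → s≤s z≤n }

  DistAtLeast-prefix : ∀ {u x v a b} → DistAtLeast G u v (a + b) → Walk G x v b → DistAtLeast G u x a
  DistAtLeast-prefix {a = a} {b} d≥ q k′ p = +-cancelʳ-≤ b a k′ (d≥ (k′ + b) (p ++ʷ q))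

  DistAtLeast-suffix : ∀ {u x v a b} → DistAtLeast G u v (a + b) → Walk G u x a → DistAtLeast G x v b
  DistAtLeast-suffix {a = a} {b} d≥ p k′ q = +-cancelˡ-≤ a b k′ (d≥ (a + k′) (p ++ʷ q))

  between-on-geodesic : ∀ {u v k} {p : Walk G u v k} → DistAtLeast G u v k →
    ∀ {y z} → y ∈W p → z ∈W p → Between G u y z ⊎ Between G u z y
  between-on-geodesic geo y∈p z∈p with splitAt y∈p
  ... | q₁ ◂ q₂ with ∈-++ʷ⁻ q₁ z∈p
  ...   | inj₁ z∈q₁ with splitAt z∈q₁
  ...     | s₁ ◂ s₂ = inj₂ (_ , _ , s₁ , s₂ , DistAtLeast-prefix geo q₂)
  between-on-geodesic {u} {v} geo y∈p z∈p | _◂_ {a} q₁ q₂ | inj₂ z∈q₂ with splitAt z∈q₂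
  ...     | _◂_ {c} {d} s₁ s₂ =
    inj₁ (_ , _ , q₁ , s₁ , DistAtLeast-prefix (subst (DistAtLeast G u v) (sym (+-assoc a c d)) geo) s₂)

  between-bound : ∀ {x y z a b c} → Between G x y z →
    DistAtLeast G x y a → DistAtLeast G y z b → Walk G x z c → a + b ≤ c
  between-bound (a′ , b′ , p , q , geo) x-y y-z w = ≤-trans (+-mono-≤ (x-y a′ p) (y-z b′ q)) (geo _ w)

  between⇒dist-+ : ∀ {x y z a b c} → Between G x y z →
    Dist G x y a → Dist G y z b → Dist G x z c → c ≡ a + b
  between⇒dist-+ xyz (p , x-y) (q , y-z) (w , x-z) =
    ≤-antisym (x-z _ (p ++ʷ q)) (between-bound xyz x-y y-z w)

  between-self : ∀ {x y} → Between G x y x → x ≡ y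
  between-self (zero  , _ , p , _ , _)   = walk-0 p
  between-self (suc _ , _ , _ , _ , geo) with geo 0 []
  ... | ()

  between-start : ∀ {x z d} → Dist G x z d → Between G x x z
  between-start (p , geo) = 0 , _ , [] , p , geo

  between-end : ∀ {x z d} → Dist G x z d → Between G x z z
  between-end {d = d} (p , geo) = d , 0 , p , [] , subst (DistAtLeast G _ _) (sym (+-identityʳ d)) geo

  inLine-start : ∀ {u v a} → Dist G u v a → InLine G u v u
  inLine-start {a = a} u-v = a , 0 , a , u-v , dist-refl , u-v , inj₁ refl

  inLine-end : ∀ {u v a} → Dist G u v a → InLine G u v v
  inLine-end {a = a} u-v = a , a , 0 , u-v , u-v , dist-refl , inj₁ (sym (+-identityʳ a))

  Collinear-rotate : ∀ {x y z} → Collinear G x y z → Collinear G y z x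
  Collinear-rotate (inj₁ zxy)        = inj₂ (inj₂ zxy)
  Collinear-rotate (inj₂ (inj₁ xyz)) = inj₁ xyz
  Collinear-rotate (inj₂ (inj₂ yzx)) = inj₂ (inj₁ yzx)

  genPos⇒¬between : ∀ {S x y z} → GenPos G S → x ∈ S → y ∈ S → z ∈ S →
    x ≢ y → y ≢ z → x ≢ z → ¬ Between G x y z
  genPos⇒¬between gp x∈S y∈S z∈S x≢y y≢z x≢z (_ , _ , p , q , geo) =
    gp (p ++ʷ q) geo _ _ _ x∈S y∈S z∈S x≢y y≢z x≢z
       (here refl) (∈-++ʷ⁺ʳ p (here refl)) (∈-++ʷ⁺ʳ p (end-∈ʷ q))

  genPos-pair : ∀ {a b} → GenPos G (a ∷ b ∷ [])
  genPos-pair _ _ _ _ _ P∈ Q∈ R∈ P≢Q Q≢R P≢R _ _ _ = pigeonhole-pair P∈ Q∈ R∈ P≢Q Q≢R P≢R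

  genPos-singleton : ∀ {a} → GenPos G (a ∷ [])
  genPos-singleton {a} p geo _ _ _ P∈ Q∈ R∈ =
    genPos-pair {a} {a} p geo _ _ _ (there P∈) (there Q∈) (there R∈)

  module _ (G-sym : Symmetric G) where

    reverse : ∀ {u v k} → Walk G u v k → Walk G v u k
    reverse []                 = []
    reverse (step {k = k} e p) = subst (Walk G _ _) (+-comm k 1) (reverse p ++ʷ step (G-sym e) [])

    DistAtLeast-reverse : ∀ {u v k} → DistAtLeast G u v k → DistAtLeast G v u k
    DistAtLeast-reverse d≥ k′ p = d≥ k′ (reverse p)

    Dist-reverse : ∀ {u v k} → Dist G u v k → Dist G v u k
    Dist-reverse (p , d≥) = reverse p , DistAtLeast-reverse d≥

    Between-reverse : ∀ {x y z} → Between G x y z → Between G z y x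
    Between-reverse (a , b , p , q , geo) =
      b , a , reverse q , reverse p , subst (DistAtLeast G _ _) (+-comm a b) (DistAtLeast-reverse geo)

    Collinear-reverse : ∀ {x y z} → Collinear G x y z → Collinear G z y x
    Collinear-reverse (inj₁ zxy)        = inj₂ (inj₂ (Between-reverse zxy))
    Collinear-reverse (inj₂ (inj₁ xyz)) = inj₂ (inj₁ (Between-reverse xyz))
    Collinear-reverse (inj₂ (inj₂ yzx)) = inj₁ (Between-reverse yzx)

    collinear-on-geodesic : ∀ {u v k} {p : Walk G u v k} → DistAtLeast G u v k →
      ∀ {x y z} → x ∈W p → y ∈W p → z ∈W p → Collinear G x y z
    collinear-on-geodesic geo (here refl) y∈p z∈p with between-on-geodesic geo y∈p z∈p
    ... | inj₁ xyz = inj₂ (inj₁ xyz)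
    ... | inj₂ xzy = inj₂ (inj₂ (Between-reverse xzy))
    collinear-on-geodesic geo x∈p (here refl) z∈p with between-on-geodesic geo x∈p z∈p
    ... | inj₁ yxz = inj₁ (Between-reverse yxz)
    ... | inj₂ yzx = inj₂ (inj₂ yzx)
    collinear-on-geodesic geo x∈p y∈p (here refl) with between-on-geodesic geo x∈p y∈p
    ... | inj₁ zxy = inj₁ zxy
    ... | inj₂ zyx = inj₂ (inj₁ (Between-reverse zyx))
    collinear-on-geodesic {p = step e _} geo (there x∈p) (there y∈p) (there z∈p) =
      collinear-on-geodesic (DistAtLeast-suffix geo (step e [])) x∈p y∈p z∈p

    genPos-triple : ∀ {x y z} → ¬ Collinear G x y z → GenPos G (x ∷ y ∷ z ∷ [])
    genPos-triple ¬xyz p geo _ _ _ P∈ Q∈ R∈ P≢Q Q≢R P≢R P∈p Q∈p R∈p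
      with triple-members {Π = _∈W p} P∈ Q∈ R∈ P≢Q Q≢R P≢R P∈p Q∈p R∈p
    ... | x∈p , y∈p , z∈p = ¬xyz (collinear-on-geodesic geo x∈p y∈p z∈p)

    collinear⇒inLine : ∀ {u v w a b c} → Dist G u v a → Dist G u w b → Dist G w v c →
      Collinear G w u v → InLine G u v w
    collinear⇒inLine {u} {v} {w} {a} {b} {c} u-v u-w w-v col = a , b , c , u-v , u-w , w-v , line col
      where
      open ≡-Reasoning
      line : Collinear G w u v → a ≡ b + c ⊎ a ≡ ∣ b - c ∣
      line (inj₁ vwu) = inj₁ (begin
        a     ≡⟨ between⇒dist-+ vwu (Dist-reverse w-v) (Dist-reverse u-w) (Dist-reverse u-v) ⟩
        c + b ≡⟨ +-comm c b ⟩
        b + c ∎)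
      line (inj₂ (inj₁ wuv)) = inj₂ (begin
        a             ≡⟨ ∣m-m+n∣≡n b a ⟨
        ∣ b - b + a ∣ ≡⟨ cong ∣ b -_∣ (between⇒dist-+ wuv (Dist-reverse u-w) u-v w-v) ⟨
        ∣ b - c ∣     ∎)
      line (inj₂ (inj₂ uvw)) = inj₂ (begin
        a             ≡⟨ ∣m-m+n∣≡n c a ⟨
        ∣ c - c + a ∣ ≡⟨ cong ∣ c -_∣ (+-comm c a) ⟩
        ∣ c - a + c ∣ ≡⟨ ∣-∣-comm c (a + c) ⟩
        ∣ a + c - c ∣ ≡⟨ cong ∣_- c ∣ (between⇒dist-+ uvw u-v (Dist-reverse w-v) u-w) ⟨
        ∣ b - c ∣     ∎)

¬¬-least : (P : ℕ → Set) → ∀ {n} → P n → ¬ ¬ (∃[ m ] P m × (∀ j → P j → m ≤ j))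
¬¬-least P {n} pn ¬least = none-upto n ≤-refl pn
  where
  none-below : ∀ b {j m} → j < m → m ≤ b → ¬ P j
  none-upto  : ∀ b {m} → m ≤ b → ¬ P m
  none-upto b {m} m≤b pm = ¬least (m , pm , λ j pj → ≮⇒≥ (λ j<m → none-below b j<m m≤b pj))
  none-below zero    () z≤n
  none-below (suc b) j<m m≤1+b = none-upto b (≤-pred (≤-trans j<m m≤1+b))

-- The least length of a walk cannot be computed, so distances are only available
-- under a double negation; every use below is inside a negated goal.
connected⇒¬¬dist : ∀ {G} → Connected G → ∀ u v → ¬ ¬ (∃[ d ] Dist G u v d)
connected⇒¬¬dist {G} conn u v = ¬¬-least (Walk G u v) (proj₂ (conn u v))

¬¬-∀-finite : ∀ {G} {Q : V G → Set} → Finite G → (∀ x → ¬ ¬ Q x) → ¬ ¬ (∀ x → Q x)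
¬¬-∀-finite {Q = Q} (xs , x∈xs) ¬¬Q ¬∀Q = ¬¬-all xs (λ Q-xs → ¬∀Q (λ x → Q-xs x (x∈xs x)))
  where
  ¬¬-all : ∀ ys → ¬ ¬ (∀ y → y ∈ ys → Q y)
  ¬¬-all []       k = k (λ _ ())
  ¬¬-all (y ∷ ys) k = ¬¬Q y λ Qy → ¬¬-all ys λ Q-ys →
    k λ { _ (here refl) → Qy ; z (there z∈ys) → Q-ys z z∈ys }

module _ {A B : Graph} where

  □-symmetric : Symmetric A → Symmetric B → Symmetric (A □ B)
  □-symmetric A-sym B-sym (inj₁ (refl , e)) = inj₁ (refl , B-sym e)
  □-symmetric A-sym B-sym (inj₂ (e , refl)) = inj₂ (A-sym e , refl)

  walk-□ˡ : ∀ {x x′ m} → Walk A x x′ m → (g : V B) → Walk (A □ B) (x , g) (x′ , g) m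
  walk-□ˡ []         g = []
  walk-□ˡ (step e p) g = step (inj₂ (e , refl)) (walk-□ˡ p g)

  walk-□ʳ : ∀ {g g′ n} (x : V A) → Walk B g g′ n → Walk (A □ B) (x , g) (x , g′) n
  walk-□ʳ x []         = []
  walk-□ʳ x (step e q) = step (inj₁ (refl , e)) (walk-□ʳ x q)

  walk-□ : ∀ {x x′ g g′ m n} → Walk A x x′ m → Walk B g g′ n →
    Walk (A □ B) (x , g) (x′ , g′) (m + n)
  walk-□ p q = walk-□ˡ p _ ++ʷ walk-□ʳ _ q

  unzip-walk : ∀ {P Q k} → Walk (A □ B) P Q k →
    ∃[ m ] ∃[ n ] (Walk A (proj₁ P) (proj₁ Q) m × Walk B (proj₂ P) (proj₂ Q) n × m + n ≡ k)
  unzip-walk [] = 0 , 0 , [] , [] , refl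
  unzip-walk (step (inj₁ (refl , e)) w) with unzip-walk w
  ... | m , n , p , q , refl = m , suc n , p , step e q , +-suc m n
  unzip-walk (step (inj₂ (e , refl)) w) with unzip-walk w
  ... | m , n , p , q , refl = suc m , n , step e p , q , refl

  DistAtLeast-□ : ∀ {x x′ g g′ m n} → DistAtLeast A x x′ m → DistAtLeast B g g′ n →
    DistAtLeast (A □ B) (x , g) (x′ , g′) (m + n)
  DistAtLeast-□ x-x′ g-g′ k w with unzip-walk w
  ... | m′ , n′ , p , q , refl = +-mono-≤ (x-x′ m′ p) (g-g′ n′ q)

  between-□ : ∀ {x y z g h l} → Between A x y z → Between B g h l →
    Between (A □ B) (x , g) (y , h) (z , l)
  between-□ (a , b , p₁ , p₂ , geoA) (c , d , q₁ , q₂ , geoB) =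
    a + c , b + d , walk-□ p₁ q₁ , walk-□ p₂ q₂ ,
    subst (DistAtLeast (A □ B) _ _) (interchange +-commutativeSemigroup a b c d) (DistAtLeast-□ geoA geoB)

  between-□⁻ : ∀ {P Q R} → Between (A □ B) P Q R →
    Between A (proj₁ P) (proj₁ Q) (proj₁ R) × Between B (proj₂ P) (proj₂ Q) (proj₂ R)
  between-□⁻ (_ , _ , w₁ , w₂ , geo) with unzip-walk w₁ | unzip-walk w₂
  ... | m₁ , n₁ , p₁ , q₁ , refl | m₂ , n₂ , p₂ , q₂ , refl =
    (m₁ , m₂ , p₁ , p₂ , geoA) , (n₁ , n₂ , q₁ , q₂ , geoB)
    where
    regroup : m₁ + n₁ + (m₂ + n₂) ≡ m₁ + m₂ + (n₁ + n₂)
    regroup = interchange +-commutativeSemigroup m₁ n₁ m₂ n₂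
    geoA : DistAtLeast A _ _ (m₁ + m₂)
    geoA j p = +-cancelʳ-≤ (n₁ + n₂) _ j
      (subst (_≤ j + (n₁ + n₂)) regroup (geo _ (walk-□ p (q₁ ++ʷ q₂))))
    geoB : DistAtLeast B _ _ (n₁ + n₂)
    geoB j q = +-cancelˡ-≤ (m₁ + m₂) _ j
      (subst (_≤ m₁ + m₂ + j) regroup (geo _ (walk-□ (p₁ ++ʷ p₂) q)))

  collinear-□⁻ : ∀ {P Q R} → Collinear (A □ B) P Q R →
    Collinear A (proj₁ P) (proj₁ Q) (proj₁ R) × Collinear B (proj₂ P) (proj₂ Q) (proj₂ R)
  collinear-□⁻ col =
    Collinear-map proj₁ (proj₁ ∘ between-□⁻) col , Collinear-map proj₂ (proj₂ ∘ between-□⁻) col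

module Cycle (k : ℕ) where

  r : ℕ
  r = suc (2 * k)

  r≡1+k+k : r ≡ suc k + k
  r≡1+k+k = cong (λ n → suc (k + n)) (+-identityʳ k)

  k<r : k < r
  k<r = s≤s (m≤m+n k (k + 0))

  short+short<r : ∀ {a b} → a ≤ k → b ≤ k → a + b < r
  short+short<r a≤k b≤k = ≤-<-trans (+-mono-≤ a≤k b≤k) (subst (k + k <_) (sym r≡1+k+k) ≤-refl)

  C-symmetric : Symmetric (C r)
  C-symmetric (inj₁ xy) = inj₂ xy
  C-symmetric (inj₂ yx) = inj₁ yx

  shift : Fin r → ℕ → Fin r
  shift x d = (toℕ x + d) mod r

  data Arc (x : Fin r) : Fin r → ℕ → Set where
    arc : ∀ d → Arc x (shift x d) d

  Arc⇒≡ : ∀ {x y d} → Arc x y d → shift x d ≡ y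
  Arc⇒≡ (arc d) = refl

  ≡⇒Arc : ∀ {x y d} → shift x d ≡ y → Arc x y d
  ≡⇒Arc refl = arc _

  toℕ-shift : ∀ x d → toℕ (shift x d) ≡ (toℕ x + d) % r
  toℕ-shift x d = toℕ-fromℕ< (m%n<n (toℕ x + d) r)

  shift-+ : ∀ x a b → shift (shift x a) b ≡ shift x (a + b)
  shift-+ x a b = toℕ-injective (begin
    toℕ (shift (shift x a) b)         ≡⟨ toℕ-shift (shift x a) b ⟩
    (toℕ (shift x a) + b) % r         ≡⟨ cong (λ n → (n + b) % r) (toℕ-shift x a) ⟩
    ((toℕ x + a) % r + b) % r         ≡⟨ %-distribˡ-+ ((toℕ x + a) % r) b r ⟩
    ((toℕ x + a) % r % r + b % r) % r ≡⟨ cong (λ n → (n + b % r) % r) (m%n%n≡m%n (toℕ x + a) r) ⟩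
    ((toℕ x + a) % r + b % r) % r     ≡⟨ %-distribˡ-+ (toℕ x + a) b r ⟨
    (toℕ x + a + b) % r               ≡⟨ cong (_% r) (+-assoc (toℕ x) a b) ⟩
    (toℕ x + (a + b)) % r             ≡⟨ toℕ-shift x (a + b) ⟨
    toℕ (shift x (a + b))             ∎)
    where open ≡-Reasoning

  arc-of-toℕ : ∀ {x y d} c → toℕ x + d ≡ toℕ y + c * r → Arc x y d
  arc-of-toℕ {x} {y} {d} c x+d≡y+cr = ≡⇒Arc (toℕ-injective (begin
    toℕ (shift x d)     ≡⟨ toℕ-shift x d ⟩
    (toℕ x + d) % r     ≡⟨ cong (_% r) x+d≡y+cr ⟩
    (toℕ y + c * r) % r ≡⟨ [m+kn]%n≡m%n (toℕ y) c r ⟩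
    toℕ y % r           ≡⟨ m<n⇒m%n≡m (toℕ<n y) ⟩
    toℕ y               ∎))
    where open ≡-Reasoning

  arc-of-≤ : ∀ {x y} → toℕ x ≤ toℕ y → ∃[ c ] c < r × Arc x y c
  arc-of-≤ {x} {y} x≤y with m≤n⇒∃[o]m+o≡n x≤y
  ... | c , x+c≡y = c , ≤-<-trans (≤-trans (m≤n+m c (toℕ x)) (≤-reflexive x+c≡y)) (toℕ<n y) ,
                    arc-of-toℕ 0 (trans x+c≡y (sym (+-identityʳ (toℕ y))))

  arc-refl : ∀ {x} → Arc x x 0
  arc-refl = arc-of-toℕ 0 refl

  arc-r : ∀ {x} → Arc x x r
  arc-r {x} = arc-of-toℕ 1 (cong (toℕ x +_) (sym (*-identityˡ r)))

  arc-0 : ∀ {x y} → Arc x y 0 → x ≡ y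
  arc-0 x→y = trans (sym (Arc⇒≡ arc-refl)) (Arc⇒≡ x→y)

  arc-trans : ∀ {x y z a b} → Arc x y a → Arc y z b → Arc x z (a + b)
  arc-trans {x} (arc a) (arc b) = ≡⇒Arc (sym (shift-+ x a b))

  arc-cancel : ∀ {x y z a b} → Arc x y a → Arc x z (a + b) → Arc y z b
  arc-cancel {x} {b = b} (arc a) x→z = ≡⇒Arc (trans (shift-+ x a b) (Arc⇒≡ x→z))

  arc-flip : ∀ {x y a b} → Arc x y a → a + b ≡ r → Arc y x b
  arc-flip x→y a+b≡r = arc-cancel x→y (subst (Arc _ _) (sym a+b≡r) arc-r)

  arc-loop⇒∣ : ∀ {x c} → Arc x x c → r ∣ c
  arc-loop⇒∣ {x} {c} loop = divides q (+-cancelˡ-≡ (toℕ x) _ _ (begin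
    toℕ x + c               ≡⟨ m≡m%n+[m/n]*n (toℕ x + c) r ⟩
    (toℕ x + c) % r + q * r ≡⟨ cong (_+ q * r) (toℕ-shift x c) ⟨
    toℕ (shift x c) + q * r ≡⟨ cong (λ y → toℕ y + q * r) (Arc⇒≡ loop) ⟩
    toℕ x + q * r           ∎))
    where
    open ≡-Reasoning
    q : ℕ
    q = (toℕ x + c) / r

  arc-≢ : ∀ {x y a} → 0 < a → a < r → Arc x y a → x ≢ y
  arc-≢ {a = suc _} _ a<r x→y refl = >⇒∤ a<r (arc-loop⇒∣ x→y)

  arc-adjacent : ∀ x → Adj (C r) x (shift x 1)
  arc-adjacent x with m≤n⇒m<n∨m≡n (toℕ<n x)
  ... | inj₁ 1+x<r = inj₁ (inj₁ (begin
    toℕ (shift x 1) ≡⟨ toℕ-shift x 1 ⟩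
    (toℕ x + 1) % r ≡⟨ cong (_% r) (+-comm (toℕ x) 1) ⟩
    suc (toℕ x) % r ≡⟨ m<n⇒m%n≡m 1+x<r ⟩
    suc (toℕ x)     ∎))
    where open ≡-Reasoning
  ... | inj₂ 1+x≡r = inj₁ (inj₂ (1+x≡r , (begin
    toℕ (shift x 1) ≡⟨ toℕ-shift x 1 ⟩
    (toℕ x + 1) % r ≡⟨ cong (_% r) (trans (+-comm (toℕ x) 1) 1+x≡r) ⟩
    r % r           ≡⟨ n%n≡0 r ⟩
    0               ∎)))
    where open ≡-Reasoning

  cycSucc⇒arc : ∀ {x y : Fin r} → CycSucc x y → Arc x y 1
  cycSucc⇒arc {x} {y} (inj₁ y≡1+x) =
    arc-of-toℕ 0 (trans (+-comm (toℕ x) 1) (trans (sym y≡1+x) (sym (+-identityʳ (toℕ y)))))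
  cycSucc⇒arc {x} {y} (inj₂ (1+x≡r , y≡0)) =
    arc-of-toℕ 1 (begin
      toℕ x + 1  ≡⟨ +-comm (toℕ x) 1 ⟩
      suc (toℕ x) ≡⟨ 1+x≡r ⟩
      r          ≡⟨ *-identityˡ r ⟨
      1 * r      ≡⟨ cong (_+ 1 * r) y≡0 ⟨
      toℕ y + 1 * r ∎)
    where open ≡-Reasoning

  adjacent⇒arc : ∀ {x y} → Adj (C r) x y → Arc x y 1 ⊎ Arc y x 1
  adjacent⇒arc = Sum.map cycSucc⇒arc cycSucc⇒arc

  walk-of-arc : ∀ {x y d} → Arc x y d → Walk (C r) x y d
  walk-of-arc {x} (arc zero)    = subst (λ y → Walk (C r) x y 0) (sym (Arc⇒≡ arc-refl)) []
  walk-of-arc {x} (arc (suc d)) = step (arc-adjacent x) (walk-of-arc (≡⇒Arc (shift-+ x 1 d)))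

  -- The forward steps of the walk make up the arc x → z, its backward steps the arc y → z.
  walk⇒arcs : ∀ {x y m} → Walk (C r) x y m → ∃[ z ] ∃[ s ] ∃[ t ] (Arc x z s × Arc y z t × s + t ≡ m)
  walk⇒arcs [] = _ , 0 , 0 , arc-refl , arc-refl , refl
  walk⇒arcs (step e w) with walk⇒arcs w | adjacent⇒arc e
  ... | z , s , t , x′→z , y→z , refl | inj₁ x→x′ = z , suc s , t , arc-trans x→x′ x′→z , y→z , refl
  ... | z , s , t , x′→z , y→z , refl | inj₂ x′→x =
    shift z 1 , s , suc t ,
    arc-cancel x′→x (subst (Arc _ _) (+-comm s 1) (arc-trans x′→z (arc 1))) ,
    subst (Arc _ _) (+-comm t 1) (arc-trans y→z (arc 1)) ,
    +-suc s t

  -- s ≡ d + t modulo r, so either d + t ≤ s or d + t ≥ s + r, and the latter forces t > k ≥ d.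
  arc-lengths-≤ : ∀ {x z s d t} → d ≤ k → Arc x z s → Arc x z (d + t) → d ≤ s + t
  arc-lengths-≤ {s = s} {d} {t} d≤k x→z x→z′ with ≤-total (d + t) s
  ... | inj₁ d+t≤s = ≤-trans (m≤m+n d t) (≤-trans d+t≤s (m≤m+n s t))
  ... | inj₂ s≤d+t with m≤n⇒∃[o]m+o≡n s≤d+t
  ...   | zero  , s+0≡d+t =
    ≤-trans (m≤m+n d t) (≤-trans (≤-reflexive (trans (sym s+0≡d+t) (+-identityʳ s))) (m≤m+n s t))
  ...   | suc c , s+c≡d+t = ≤-trans (≤-trans d≤k (<⇒≤ k<t)) (m≤n+m t s)
    where
    r∣1+c : r ∣ suc c
    r∣1+c = arc-loop⇒∣ (arc-cancel x→z (subst (Arc _ _) (sym s+c≡d+t) x→z′))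
    k<t : k < t
    k<t = +-cancelˡ-≤ k (suc k) t (begin
      k + suc k ≡⟨ +-suc k k ⟩
      suc k + k ≡⟨ r≡1+k+k ⟨
      r         ≤⟨ ∣⇒≤ r∣1+c ⟩
      suc c     ≤⟨ m≤n+m (suc c) s ⟩
      s + suc c ≡⟨ s+c≡d+t ⟩
      d + t     ≤⟨ +-monoˡ-≤ t d≤k ⟩
      k + t     ∎)
      where open ≤-Reasoning

  arc-dist : ∀ {x y d} → d ≤ k → Arc x y d → Dist (C r) x y d
  arc-dist {x} {y} {d} d≤k x→y = walk-of-arc x→y , lower-bound
    where
    lower-bound : DistAtLeast (C r) x y d
    lower-bound _ w with walk⇒arcs w
    ... | _ , _ , _ , x→z , y→z , refl = arc-lengths-≤ d≤k x→z (arc-trans x→y y→z)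

  arcs⇒between : ∀ {x y z p q} → p + q ≤ k → Arc x y p → Arc y z q → Between (C r) x y z
  arcs⇒between p+q≤k x→y y→z =
    _ , _ , walk-of-arc x→y , walk-of-arc y→z , proj₂ (arc-dist p+q≤k (arc-trans x→y y→z))

  shorten-arc : ∀ {x y c} → c < r → Arc x y c → ∃[ e ] e ≤ k × (Arc x y e ⊎ Arc y x e)
  shorten-arc {c = c} c<r x→y with c ≤? k
  ... | yes c≤k = c , c≤k , inj₁ x→y
  ... | no  c≰k with m≤n⇒∃[o]m+o≡n (<⇒≤ c<r)
  ...   | b , c+b≡r = b , b≤k , inj₂ (arc-flip x→y c+b≡r)
    where
    b≤k : b ≤ k
    b≤k = +-cancelˡ-≤ (suc k) b k
      (≤-trans (+-monoˡ-≤ b (≰⇒> c≰k)) (≤-reflexive (trans c+b≡r r≡1+k+k)))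

  short-arc : ∀ x y → ∃[ e ] e ≤ k × (Arc x y e ⊎ Arc y x e)
  short-arc x y with ≤-total (toℕ x) (toℕ y)
  ... | inj₁ x≤y with arc-of-≤ x≤y
  ...   | _ , c<r , x→y = shorten-arc c<r x→y
  short-arc x y | inj₂ y≤x with arc-of-≤ y≤x
  ...   | _ , c<r , y→x with shorten-arc c<r y→x
  ...     | e , e≤k , arcs = e , e≤k , Sum.swap arcs

  record ShortTriangle (x y z : Fin r) : Set where
    constructor shortTriangle
    field
      {p q e}   : ℕ
      x→y       : Arc x y p
      y→z       : Arc y z q
      z→x       : Arc z x e
      perimeter : p + q + e ≡ r
      p≤k       : p ≤ k
      q≤k       : q ≤ k
      e≤k       : e ≤ k

  ShortTriangle-rotate : ∀ {x y z} → ShortTriangle x y z → ShortTriangle y z x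
  ShortTriangle-rotate (shortTriangle {p} {q} {e} x→y y→z z→x perimeter p≤k q≤k e≤k) =
    shortTriangle y→z z→x x→y (trans (+-comm (q + e) p) (trans (sym (+-assoc p q e)) perimeter))
                  q≤k e≤k p≤k

  -- The arc lengths are the distances, and p + q = r − e > k ≥ e.
  shortTriangle⇒¬between : ∀ {x y z} → ShortTriangle x y z → ¬ Between (C r) x y z
  shortTriangle⇒¬between (shortTriangle {p} {q} {e} x→y y→z z→x perimeter p≤k q≤k e≤k) xyz =
    <-irrefl perimeter (≤-<-trans (+-monoˡ-≤ e p+q≤e) (short+short<r e≤k e≤k))
    where
    p+q≤e : p + q ≤ e
    p+q≤e = between-bound xyz (proj₂ (arc-dist p≤k x→y)) (proj₂ (arc-dist q≤k y→z))
                              (reverse C-symmetric (walk-of-arc z→x))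

  shortTriangle⇒¬collinear : ∀ {x y z} → ShortTriangle x y z → ¬ Collinear (C r) x y z
  shortTriangle⇒¬collinear t (inj₁ zxy) =
    shortTriangle⇒¬between (ShortTriangle-rotate (ShortTriangle-rotate t)) zxy
  shortTriangle⇒¬collinear t (inj₂ (inj₁ xyz)) = shortTriangle⇒¬between t xyz
  shortTriangle⇒¬collinear t (inj₂ (inj₂ yzx)) = shortTriangle⇒¬between (ShortTriangle-rotate t) yzx

  shortTriangle⇒≢ : ∀ {x y z} → ShortTriangle x y z → x ≢ y
  shortTriangle⇒≢ (shortTriangle {zero} _ _ _ perimeter _ q≤k e≤k) _ =
    <-irrefl perimeter (short+short<r q≤k e≤k)
  shortTriangle⇒≢ (shortTriangle {suc _} x→y _ _ _ p≤k _ _) = arc-≢ (s≤s z≤n) (≤-<-trans p≤k k<r) x→y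

  shortTriangle⇒distinct : ∀ {x y z} → ShortTriangle x y z → x ≢ y × y ≢ z × z ≢ x
  shortTriangle⇒distinct t =
    shortTriangle⇒≢ t ,
    shortTriangle⇒≢ (ShortTriangle-rotate t) ,
    shortTriangle⇒≢ (ShortTriangle-rotate (ShortTriangle-rotate t))

  shortTriangle-apex : ∀ {x y e} → Arc x y e → 0 < e → e ≤ k → ShortTriangle x y (shift x (suc k))
  shortTriangle-apex {x} {e = e} x→y 0<e e≤k with m≤n⇒∃[o]m+o≡n (m≤n⇒m≤1+n e≤k)
  ... | q , e+q≡1+k =
    shortTriangle x→y (arc-cancel x→y (subst (Arc x _) (sym e+q≡1+k) (arc (suc k))))
                  (arc-flip (arc (suc k)) (sym r≡1+k+k))
                  (trans (cong (_+ k) e+q≡1+k) (sym r≡1+k+k)) e≤k q≤k ≤-refl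
    where
    q≤k : q ≤ k
    q≤k = ≤-pred (≤-trans (+-monoˡ-≤ q 0<e) (≤-reflexive e+q≡1+k))

  noncollinear-third : ∀ {x y} → x ≢ y → ∃[ w ] (w ≢ x × w ≢ y × ¬ Collinear (C r) w x y)
  noncollinear-third x≢y with short-arc _ _
  ... | zero  , _   , inj₁ x→y = ⊥-elim (x≢y (arc-0 x→y))
  ... | zero  , _   , inj₂ y→x = ⊥-elim (x≢y (sym (arc-0 y→x)))
  ... | suc _ , e≤k , inj₁ x→y with shortTriangle-apex x→y (s≤s z≤n) e≤k
  ...   | xyw = let (_ , y≢w , w≢x) = shortTriangle⇒distinct xyw in
                _ , w≢x , ≢-sym y≢w , shortTriangle⇒¬collinear xyw ∘ Collinear-rotate
  noncollinear-third x≢y | suc _ , e≤k , inj₂ y→x with shortTriangle-apex y→x (s≤s z≤n) e≤k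
  ...   | yxw = let (_ , x≢w , w≢y) = shortTriangle⇒distinct yxw in
                _ , ≢-sym x≢w , w≢y , shortTriangle⇒¬collinear yxw ∘ Collinear-reverse C-symmetric

  a₀ a₁ a₂ : Fin r
  a₀ = zero
  a₁ = shift a₀ k
  a₂ = shift a₀ (suc k)

  a₁→a₂ : Arc a₁ a₂ 1
  a₁→a₂ = arc-cancel (arc k) (subst (Arc a₀ a₂) (+-comm 1 k) (arc (suc k)))

  a₀a₁a₂-triangle : 1 ≤ k → ShortTriangle a₀ a₁ a₂
  a₀a₁a₂-triangle 1≤k = shortTriangle (arc k) a₁→a₂ (arc-flip (arc (suc k)) (sym r≡1+k+k))
    (trans (cong (_+ k) (+-comm k 1)) (sym r≡1+k+k)) ≤-refl 1≤k ≤-refl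

  SeesTwoOf-a₀a₁a₂ : Fin r → Set
  SeesTwoOf-a₀a₁a₂ i = Between (C r) i a₀ a₁ ⊎ Between (C r) i a₁ a₂ ⊎ Between (C r) i a₂ a₁

  a₀a₁a₂-cover : ∀ i → SeesTwoOf-a₀a₁a₂ i
  a₀a₁a₂-cover i = cover (arc-of-toℕ 0 (sym (+-identityʳ (toℕ i)))) (toℕ<n i)
    where
    cover : ∀ {n} → Arc a₀ i n → n < r → SeesTwoOf-a₀a₁a₂ i
    cover {zero} a₀→i _ =
      inj₁ (subst (λ x → Between (C r) x a₀ a₁) (arc-0 a₀→i) (between-start (arc-dist ≤-refl (arc k))))
    cover {suc n} a₀→i n<r with suc n ≤? k
    ... | yes n<k with m≤n⇒∃[o]m+o≡n n<k
    ...   | o , 1+n+o≡k =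
      inj₂ (inj₁ (arcs⇒between o+1≤k i→a₁ a₁→a₂))
      where
      i→a₁ : Arc i a₁ o
      i→a₁ = arc-cancel a₀→i (subst (Arc a₀ a₁) (sym 1+n+o≡k) (arc k))
      o+1≤k : o + 1 ≤ k
      o+1≤k = ≤-trans (≤-reflexive (+-comm o 1)) (≤-trans (+-monoˡ-≤ o (s≤s z≤n)) (≤-reflexive 1+n+o≡k))
    cover {suc n} a₀→i n<r | no n≮k with m≤n⇒∃[o]m+o≡n (≰⇒> n≮k)
    ...   | o , 1+k+o≡1+n = inj₂ (inj₂ (Between-reverse C-symmetric (arcs⇒between 1+o≤k a₁→a₂ a₂→i)))
      where
      a₂→i : Arc a₂ i o
      a₂→i = arc-cancel (arc (suc k)) (subst (Arc a₀ i) (sym 1+k+o≡1+n) a₀→i)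
      1+o≤k : 1 + o ≤ k
      1+o≤k = +-cancelˡ-≤ (suc k) (suc o) k (begin
        suc k + suc o   ≡⟨ +-suc (suc k) o ⟩
        suc (suc k + o) ≡⟨ cong suc 1+k+o≡1+n ⟩
        suc (suc n)     ≤⟨ n<r ⟩
        r               ≡⟨ r≡1+k+k ⟩
        suc k + k       ∎)
        where open ≤-Reasoning

  shift-1-≢ : 1 ≤ k → ∀ x → shift x 1 ≢ x
  shift-1-≢ 1≤k x = ≢-sym (arc-≢ (s≤s z≤n) (≤-<-trans 1≤k k<r) (arc 1))

module CycleProduct (k : ℕ) (1≤k : 1 ≤ k) (H : Graph) (H-sym : Symmetric H) (H-conn : Connected H) where

  open Cycle k

  G : Graph
  G = C r □ H

  G-sym : Symmetric G
  G-sym = □-symmetric C-symmetric H-sym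

  S₀ : V H → List (V G)
  S₀ h = (a₀ , h) ∷ (a₁ , h) ∷ (a₂ , h) ∷ []

  S₀-maximalGP : ∀ h → MaximalGP G (S₀ h)
  S₀-maximalGP h with shortTriangle⇒distinct (a₀a₁a₂-triangle 1≤k)
  ... | a₀≢a₁ , a₁≢a₂ , a₂≢a₀ =
    unique , genPos-triple G-sym (shortTriangle⇒¬collinear (a₀a₁a₂-triangle 1≤k) ∘ proj₁ ∘ collinear-□⁻) ,
    maximal
    where
    unique : Unique (S₀ h)
    unique = (≢⇒,≢ a₀≢a₁ ∷ ≢⇒,≢ (≢-sym a₂≢a₀) ∷ []) ∷ (≢⇒,≢ a₁≢a₂ ∷ []) ∷ [] ∷ []

    maximal : ∀ x → x ∉ S₀ h → ¬ GenPos G (x ∷ S₀ h)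
    maximal (i , g) x∉S₀ gp = connected⇒¬¬dist H-conn g h λ { (_ , g-h) →
      Sum.[ blocked g-h 1st 2nd a₀≢a₁ ,
      Sum.[ blocked g-h 2nd 3rd a₁≢a₂ ,
            blocked g-h 3rd 2nd (≢-sym a₁≢a₂) ]′ ]′ (a₀a₁a₂-cover i) }
      where
      blocked : ∀ {d X Y} → Dist H g h d → (X , h) ∈ S₀ h → (Y , h) ∈ S₀ h → X ≢ Y →
        ¬ Between (C r) i X Y
      blocked g-h X∈ Y∈ X≢Y iXY =
        genPos⇒¬between gp (here refl) (there X∈) (there Y∈)
          (λ x≡X → x∉S₀ (subst (_∈ S₀ h) (sym x≡X) X∈)) (≢⇒,≢ X≢Y)
          (λ x≡Y → x∉S₀ (subst (_∈ S₀ h) (sym x≡Y) Y∈))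
          (between-□ iXY (between-end g-h))

  empty-extendable : V H → Extendable G []
  empty-extendable h = (a₀ , h) , (λ ()) , genPos-singleton

  singleton-extendable : ∀ x → Extendable G (x ∷ [])
  singleton-extendable (i , g) =
    (shift i 1 , g) , (λ { (here eq) → ≢⇒,≢ (shift-1-≢ 1≤k i) eq ; (there ()) }) , genPos-pair

  layers-extendable : ∀ {i j g h} → i ≢ j → Extendable G ((i , g) ∷ (j , h) ∷ [])
  layers-extendable {g = g} i≢j with noncollinear-third i≢j
  ... | w , w≢i , w≢j , ¬wij =
    (w , g) , ∉-pair (≢⇒,≢ w≢i) (≢⇒,≢ w≢j) , genPos-triple G-sym (¬wij ∘ proj₁ ∘ collinear-□⁻)

  far-extendable : ∀ i {g h δ} → Dist H g h (suc (suc δ)) → Extendable G ((i , g) ∷ (i , h) ∷ [])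
  far-extendable i {g} {h} (step {w = f} e rest , g-h) =
    (shift i 1 , f) , ∉-pair (≢⇒,≢ i′≢i) (≢⇒,≢ i′≢i) , genPos-triple G-sym ¬collinear
    where
    i′≢i : shift i 1 ≢ i
    i′≢i = shift-1-≢ 1≤k i
    ¬collinear : ¬ Collinear G (shift i 1 , f) (i , g) (i , h)
    ¬collinear (inj₁ hxg)        = i′≢i (sym (between-self (proj₁ (between-□⁻ hxg))))
    ¬collinear (inj₂ (inj₁ xgh)) = 1+n≰n (between-bound (proj₂ (between-□⁻ xgh)) (λ _ _ → z≤n) g-h rest)
    ¬collinear (inj₂ (inj₂ ghx)) with between-bound (proj₂ (between-□⁻ ghx)) g-h (λ _ _ → z≤n) (step e [])
    ... | s≤s ()

  off-line-extendable : ∀ i {g h f d} → Dist H g h d → ¬ InLine H g h f →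
    Extendable G ((i , g) ∷ (i , h) ∷ [])
  off-line-extendable i {g} {h} {f} g-h f∉gh =
    (i , f) , ∉-pair (λ eq → f∉gh (subst (InLine H g h) (sym (cong proj₂ eq)) (inLine-start g-h)))
                     (λ eq → f∉gh (subst (InLine H g h) (sym (cong proj₂ eq)) (inLine-end g-h))) ,
    genPos-triple G-sym λ col →
      connected⇒¬¬dist H-conn g f λ { (_ , g-f) → connected⇒¬¬dist H-conn f h λ { (_ , f-h) →
        f∉gh (collinear⇒inLine H-sym g-h g-f f-h (proj₂ (collinear-□⁻ col))) } }

  same-layer-extendable : Finite H → ¬ AdjacentUniversalLine H →
    ∀ i {g h} → g ≢ h → ¬ ¬ Extendable G ((i , g) ∷ (i , h) ∷ [])
  same-layer-extendable fin noUL i {g} {h} g≢h ¬ext = connected⇒¬¬dist H-conn g h λ where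
    (zero , g-h)               → g≢h (walk-0 (proj₁ g-h))
    (suc zero , step e [] , _) →
      ¬¬-∀-finite {H} {InLine H g h} fin
        (λ f f∉gh → ¬ext (off-line-extendable i (adjacent⇒dist-1 g≢h e) f∉gh))
        (λ universal → noUL (g , h , e , universal))
    (suc (suc _) , g-h)        → ¬ext (far-extendable i g-h)

  pair-extendable : Finite H → ¬ AdjacentUniversalLine H →
    ∀ {x y} → x ≢ y → ¬ ¬ Extendable G (x ∷ y ∷ [])
  pair-extendable fin noUL {i , g} {j , h} x≢y with i ≟ j
  ... | no  i≢j  = λ ¬ext → ¬ext (layers-extendable i≢j)
  ... | yes refl = same-layer-extendable fin noUL i (x≢y ∘ cong (i ,_))

  maximalGP-length≥3 : Finite H → ¬ AdjacentUniversalLine H → V H →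
    ∀ S → MaximalGP G S → 3 ≤ length S
  maximalGP-length≥3 _   _    h []           M = ⊥-elim (extendable⇒¬maximalGP (empty-extendable h) M)
  maximalGP-length≥3 _   _    _ (x ∷ [])     M = ⊥-elim (extendable⇒¬maximalGP (singleton-extendable x) M)
  maximalGP-length≥3 fin noUL _ (x ∷ y ∷ []) M@(((x≢y ∷ []) ∷ _) , _) =
    ⊥-elim (pair-extendable fin noUL x≢y (λ ext → extendable⇒¬maximalGP ext M))
  maximalGP-length≥3 _   _    _ (_ ∷ _ ∷ _ ∷ _) _ = s≤s (s≤s (s≤s z≤n))

corollary2p4 : (H : Graph) → Finite H → Symmetric H → Irreflexive H →
    Connected H → V H → (r : ℕ) → 3 ≤ r → Odd r →
    ¬ (∃[ u ] ∃[ v ] (Adj H u v × UniversalLine H u v)) →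
    gpMinus≡ (C r □ H) 3
corollary2p4 _ _ _ _ _ _ _ (s≤s ()) (zero , refl) _
corollary2p4 H fin H-sym _ H-conn h₀ _ _ (suc k , refl) noUL =
  (S₀ h₀ , S₀-maximalGP h₀ , refl) , maximalGP-length≥3 fin noUL h₀
  where open CycleProduct (suc k) (s≤s z≤n) H H-sym H-conn
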